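{- Let $G_1$ and $G_2$ be graphs with disjoint vertex sets. Then $\mathrm{compthin}(G_1\cup G_2)=\mathrm{compthin}(G_1)+\mathrm{compthin}(G_2)$ and $\mathrm{comppthin}(G_1\cup G_2)=\mathrm{comppthin}(G_1)+\mathrm{comppthin}(G_2)$.
   Context: Graphs are finite, simple, undirected. The union $G_1\cup G_2$ is $(V_1\cup V_2, E_1\cup E_2)$. For a graph $G=(V,E)$, an ordering $v_1,\dots,v_n$ of $V$ and a partition of $V$ are consistent if for every $r<s<t$, whenever $v_r,v_s$ are in the same class and $v_tv_r\in E$, then $v_tv_s\in E$; they are strongly consistent if moreover for every $r<s<t$, whenever $v_s,v_t$ are in the same class and $v_tv_r\in E$, then $v_sv_r\in E$. $\mathrm{compthin}(G)$ (complete thinness) is the minimum $k$ such that some ordering of $V$ and some partition of $V$ into $k$ cliques are consistent; $\mathrm{comppthin}(G)$ (complete proper thinness) is defined likewise with strongly consistent. -}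

module Defs where

open import Data.Nat using (ℕ; _+_; _≤_)
open import Data.Fin using (Fin; _<_; splitAt)
open import Data.Fin.Permutation using (Permutation′; _⟨$⟩ʳ_)
open import Data.Bool using (Bool; true; false)
open import Data.Sum using (_⊎_; inj₁; inj₂)
open import Data.Product using (Σ; ∃; _×_)
open import Relation.Binary.PropositionalEquality using (_≡_)
open import Function.Definitions using (Surjective)

record Graph : Set where
  field
    n      : ℕ
    adj    : Fin n → Fin n → Bool
    sym    : ∀ u v → adj u v ≡ adj v u
    irrefl : ∀ v → adj v v ≡ false
open Graph public

E : (G : Graph) → Fin (n G) → Fin (n G) → Set
E G u v = adj G u v ≡ true

-- Union of two graphs with disjoint vertex sets: vertex set Fin n₁ ⊎ Fin n₂
-- encoded as Fin (n₁ + n₂) via splitAt; edge set = union of edge sets.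
unionAdj : ∀ {a b} → (Fin a → Fin a → Bool) → (Fin b → Fin b → Bool)
         → Fin a ⊎ Fin b → Fin a ⊎ Fin b → Bool
unionAdj f g (inj₁ x) (inj₁ y) = f x y
unionAdj f g (inj₂ x) (inj₂ y) = g x y
unionAdj f g (inj₁ x) (inj₂ y) = false
unionAdj f g (inj₂ x) (inj₁ y) = false

unionSym : ∀ {a b} (f : Fin a → Fin a → Bool) (g : Fin b → Fin b → Bool)
         → (∀ u v → f u v ≡ f v u) → (∀ u v → g u v ≡ g v u)
         → ∀ u v → unionAdj f g u v ≡ unionAdj f g v u
unionSym f g sf sg (inj₁ x) (inj₁ y) = sf x y
unionSym f g sf sg (inj₂ x) (inj₂ y) = sg x y
unionSym f g sf sg (inj₁ x) (inj₂ y) = Relation.Binary.PropositionalEquality.refl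
unionSym f g sf sg (inj₂ x) (inj₁ y) = Relation.Binary.PropositionalEquality.refl

unionIrr : ∀ {a b} (f : Fin a → Fin a → Bool) (g : Fin b → Fin b → Bool)
         → (∀ v → f v v ≡ false) → (∀ v → g v v ≡ false)
         → ∀ v → unionAdj f g v v ≡ false
unionIrr f g if ig (inj₁ x) = if x
unionIrr f g if ig (inj₂ x) = ig x

_∪G_ : Graph → Graph → Graph
G₁ ∪G G₂ = record
  { n      = n G₁ + n G₂
  ; adj    = λ u v → unionAdj (adj G₁) (adj G₂) (splitAt (n G₁) u) (splitAt (n G₁) v)
  ; sym    = λ u v → unionSym (adj G₁) (adj G₂) (sym G₁) (sym G₂) (splitAt (n G₁) u) (splitAt (n G₁) v)
  ; irrefl = λ v → unionIrr (adj G₁) (adj G₂) (irrefl G₁) (irrefl G₂) (splitAt (n G₁) v)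
  }

-- An ordering v_1..v_n: σ maps position i to the vertex v_i.
-- A partition into k classes: a surjective class map c : V → Fin k
-- (surjective = all k classes nonempty).

Consistent : (G : Graph) → Permutation′ (n G) → ∀ {k} → (Fin (n G) → Fin k) → Set
Consistent G σ c = ∀ (r s t : Fin (n G)) → r < s → s < t →
  c (σ ⟨$⟩ʳ r) ≡ c (σ ⟨$⟩ʳ s) → E G (σ ⟨$⟩ʳ t) (σ ⟨$⟩ʳ r) → E G (σ ⟨$⟩ʳ t) (σ ⟨$⟩ʳ s)

StronglyConsistent : (G : Graph) → Permutation′ (n G) → ∀ {k} → (Fin (n G) → Fin k) → Set
StronglyConsistent G σ c = Consistent G σ c ×
  (∀ (r s t : Fin (n G)) → r < s → s < t →
    c (σ ⟨$⟩ʳ s) ≡ c (σ ⟨$⟩ʳ t) → E G (σ ⟨$⟩ʳ t) (σ ⟨$⟩ʳ r) → E G (σ ⟨$⟩ʳ s) (σ ⟨$⟩ʳ r))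

CliquePartition : (G : Graph) → ∀ {k} → (Fin (n G) → Fin k) → Set
CliquePartition G {k} c = Surjective _≡_ _≡_ c ×
  (∀ u v → c u ≡ c v → u ≡ v ⊎ E G u v)

CompThinWith : Graph → ℕ → Set
CompThinWith G k = Σ (Permutation′ (n G)) λ σ → Σ (Fin (n G) → Fin k) λ c →
  CliquePartition G c × Consistent G σ c

CompPThinWith : Graph → ℕ → Set
CompPThinWith G k = Σ (Permutation′ (n G)) λ σ → Σ (Fin (n G) → Fin k) λ c →
  CliquePartition G c × StronglyConsistent G σ c

IsMin : (ℕ → Set) → ℕ → Set
IsMin P k = P k × (∀ k′ → P k′ → k ≤ k′)

IsCompThin : Graph → ℕ → Set
IsCompThin G = IsMin (CompThinWith G)

IsCompPThin : Graph → ℕ → Set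
IsCompPThin G = IsMin (CompPThinWith G)

module Submission where

-- Write U for G₁ ∪G G₂.  Upper bound: witnesses for G₁ and G₂ combine by ordering
-- all of G₁ before all of G₂ and taking the classes of G₁ followed by those of G₂.
-- A triple of vertices inside one summand inherits the (strong) consistency
-- conditions from that summand, and a triple meeting both summands satisfies them
-- vacuously, because neither a class nor an edge can join the two summands.
-- Lower bound: a witness for U restricts to each Gᵢ by ordering Gᵢ as U is
-- ordered and keeping only the classes that meet Gᵢ; a clique class cannot meet
-- both summands, so the two restrictions use disjoint sets of classes.

open import Defs hiding (sym)
open import Data.Nat as ℕ using (ℕ; zero; suc; _+_; z≤n; s≤s)
import Data.Nat.Properties as ℕP
open import Data.Fin as F using (Fin; zero; suc; toℕ; fromℕ<; _↑ˡ_; _↑ʳ_; splitAt; join)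
import Data.Fin.Properties as FP
open import Data.Fin.Permutation using (Permutation; Permutation′; _⟨$⟩ʳ_; _⟨$⟩ˡ_; inverseˡ; inverseʳ; cast-id; ↔⇒≡)
open import Data.Product using (Σ; ∃; _×_; _,_; proj₁; proj₂)
open import Data.Sum as Sum using (_⊎_; inj₁; inj₂)
open import Data.Empty using (⊥-elim)
open import Relation.Nullary using (Dec; yes; no; ¬_)
open import Relation.Unary using (Decidable)
open import Relation.Binary.Definitions using (tri<; tri≈; tri>)
open import Relation.Binary.PropositionalEquality using (_≡_; _≢_; refl; sym; trans; cong; subst; subst₂)
open import Function.Base using (_∘_)
open import Function.Bundles using (_⇔_; mk⇔; Equivalence; mk⤖)
open import Function.Definitions using (Injective; Surjective)
open import Function.Properties.Bijection using (⤖⇒↔)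
open import Function.Construct.Composition using (_↔-∘_)
open import Function.Construct.Symmetry using (↔-sym)
open import Data.Sum.Function.Propositional using (_⊎-↔_)

indicator : ∀ {A : Set} → Dec A → ℕ
indicator (yes _) = 1
indicator (no _)  = 0

count : ∀ {N} {P : Fin N → Set} → Decidable P → ℕ
count {zero}  P? = 0
count {suc N} P? = indicator (P? zero) + count (λ i → P? (suc i))

rank : ∀ {N} {P : Fin N → Set} → Decidable P → Fin N → ℕ
rank P? zero    = 0
rank P? (suc j) = indicator (P? zero) + rank (λ i → P? (suc i)) j

rank<count : ∀ {N} {P : Fin N → Set} (P? : Decidable P) {j} → P j → rank P? j ℕ.< count P?
rank<count P? {zero} pj with P? zero
... | yes _  = s≤s z≤n
... | no ¬p0 = ⊥-elim (¬p0 pj)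
rank<count P? {suc j} pj with P? zero
... | yes _ = s≤s (rank<count (λ i → P? (suc i)) pj)
... | no _  = rank<count (λ i → P? (suc i)) pj

rank-mono : ∀ {N} {P : Fin N → Set} (P? : Decidable P) {i j} → i F.< j → P i → rank P? i ℕ.< rank P? j
rank-mono P? {zero} {suc j} _ pi with P? zero
... | yes _  = s≤s z≤n
... | no ¬p0 = ⊥-elim (¬p0 pi)
rank-mono P? {suc i} {suc j} (s≤s i<j) pi with P? zero
... | yes _ = s≤s (rank-mono (λ k → P? (suc k)) i<j pi)
... | no _  = rank-mono (λ k → P? (suc k)) i<j pi

rank-surjective : ∀ {N} {P : Fin N → Set} (P? : Decidable P) r → r ℕ.< count P? →
                  ∃ λ j → P j × rank P? j ≡ r
rank-surjective {suc N} P? r r<count with P? zero in p0?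
rank-surjective {suc N} P? zero    _             | yes p0 = zero , p0 , refl
rank-surjective {suc N} P? (suc r) (s≤s r<count) | yes _
  with rank-surjective (λ i → P? (suc i)) r r<count
... | j , pj , rank≡r = suc j , pj , trans (cong (λ d → indicator d + rank (λ i → P? (suc i)) j) p0?) (cong suc rank≡r)
rank-surjective {suc N} P? r r<count | no _
  with rank-surjective (λ i → P? (suc i)) r r<count
... | j , pj , rank≡r = suc j , pj , trans (cong (λ d → indicator d + rank (λ i → P? (suc i)) j) p0?) rank≡r

rank-injective : ∀ {N} {P : Fin N → Set} (P? : Decidable P) {i j} → P i → P j →
                 rank P? i ≡ rank P? j → i ≡ j
rank-injective P? {i} {j} pi pj eq with FP.<-cmp i j
... | tri< i<j _ _ = ⊥-elim (ℕP.<-irrefl eq (rank-mono P? i<j pi))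
... | tri≈ _ i≡j _ = i≡j
... | tri> _ _ j<i = ⊥-elim (ℕP.<-irrefl (sym eq) (rank-mono P? j<i pj))

rank-reflects-< : ∀ {N} {P : Fin N → Set} (P? : Decidable P) {i j} → P j →
                  rank P? i ℕ.< rank P? j → i F.< j
rank-reflects-< P? {i} {j} pj lt with FP.<-cmp i j
... | tri< i<j _ _ = i<j
... | tri≈ _ refl _ = ⊥-elim (ℕP.<-irrefl refl lt)
... | tri> _ _ j<i = ⊥-elim (ℕP.<-asym lt (rank-mono P? j<i pj))

count-disjoint : ∀ {N} {P Q : Fin N → Set} (P? : Decidable P) (Q? : Decidable Q) →
                 (∀ j → P j → ¬ Q j) → count P? + count Q? ℕ.≤ N
count-disjoint {zero} P? Q? _ = z≤n
count-disjoint {suc N} P? Q? disj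
  with P? zero | Q? zero | count-disjoint (λ i → P? (suc i)) (λ i → Q? (suc i)) (λ j → disj (suc j))
... | yes p | yes q | _  = ⊥-elim (disj zero p q)
... | yes _ | no _  | ih = s≤s ih
... | no _  | yes _ | ih = subst (ℕ._≤ suc N) (sym (ℕP.+-suc _ _)) (s≤s ih)
... | no _  | no _  | ih = ℕP.m≤n⇒m≤1+n ih

-- Relabelling a map by the rank of its values: the image of h : Fin m → Fin N
-- is enumerated as Fin size, and label x is the position of h x in it.
module ImageRank {m N : ℕ} (h : Fin m → Fin N) where
  InImage : Fin N → Set
  InImage j = ∃ λ x → h x ≡ j

  inImage? : Decidable InImage
  inImage? j = FP.any? (λ x → h x F.≟ j)

  size : ℕ
  size = count inImage?

  label : Fin m → Fin size
  label x = fromℕ< (rank<count inImage? (x , refl))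

  toℕ-label : ∀ x → toℕ (label x) ≡ rank inImage? (h x)
  toℕ-label x = FP.toℕ-fromℕ< _

  label-≡ : ∀ x y → label x ≡ label y ⇔ h x ≡ h y
  label-≡ x y = mk⇔
    (λ eq → rank-injective inImage? (x , refl) (y , refl)
              (trans (sym (toℕ-label x)) (trans (cong toℕ eq) (toℕ-label y))))
    (λ eq → FP.toℕ-injective
              (trans (toℕ-label x) (trans (cong (rank inImage?) eq) (sym (toℕ-label y)))))

  label-reflects-< : ∀ x y → toℕ (label x) ℕ.< toℕ (label y) → h x F.< h y
  label-reflects-< x y lt = rank-reflects-< inImage? (y , refl)
    (subst₂ ℕ._<_ (toℕ-label x) (toℕ-label y) lt)

  label-surjective : Surjective _≡_ _≡_ label
  label-surjective r with rank-surjective inImage? (toℕ r) (FP.toℕ<n r)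
  ... | j , (x , hx≡j) , rank≡r =
    x , λ { refl → FP.toℕ-injective (trans (toℕ-label x) (trans (cong (rank inImage?) hx≡j) rank≡r)) }

position : ∀ {N} → Permutation′ N → Fin N → ℕ
position σ v = toℕ (σ ⟨$⟩ˡ v)

inverse-injective : ∀ {N} (σ : Permutation′ N) → Injective _≡_ _≡_ (σ ⟨$⟩ˡ_)
inverse-injective σ eq = trans (sym (inverseʳ σ)) (trans (cong (σ ⟨$⟩ʳ_) eq) (inverseʳ σ))

inducedOrdering : ∀ {m N} (h : Fin m → Fin N) → Injective _≡_ _≡_ h →
  Σ (Permutation′ m) λ π → ∀ x y → position π x ℕ.< position π y → h x F.< h y
inducedOrdering {m} h h-injective = π , order
  where
  open ImageRank h
  label-injective : Injective _≡_ _≡_ label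
  label-injective eq = h-injective (Equivalence.to (label-≡ _ _) eq)
  byLabel : Permutation m size
  byLabel = ⤖⇒↔ (mk⤖ (label-injective , label-surjective))
  π : Permutation′ m
  π = ↔-sym (cast-id (sym (↔⇒≡ byLabel)) ↔-∘ byLabel)
  order : ∀ x y → position π x ℕ.< position π y → h x F.< h y
  order x y lt = label-reflects-< x y
    (subst₂ ℕ._<_ (FP.toℕ-cast _ (label x)) (FP.toℕ-cast _ (label y)) lt)

InSequence : ∀ {N} → Permutation′ N → (Fin N → Fin N → Fin N → Set) → Set
InSequence σ P = ∀ r s t → r F.< s → s F.< t → P (σ ⟨$⟩ʳ r) (σ ⟨$⟩ʳ s) (σ ⟨$⟩ʳ t)

-- For ord = position σ the two notions agree (the next two lemmas); the
-- vertex-based form is the one that transfers along maps of vertices.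
InOrder : ∀ {V : Set} → (V → ℕ) → (V → V → V → Set) → Set
InOrder ord P = ∀ u v w → ord u ℕ.< ord v → ord v ℕ.< ord w → P u v w

inSequence⇒inOrder : ∀ {N} (σ : Permutation′ N) {P : Fin N → Fin N → Fin N → Set} →
                     InSequence σ P → InOrder (position σ) P
inSequence⇒inOrder σ {P} h u v w u<v v<w =
  transport (inverseʳ σ) (inverseʳ σ) (inverseʳ σ) (h _ _ _ u<v v<w)
  where
  transport : ∀ {u u′ v v′ w w′} → u ≡ u′ → v ≡ v′ → w ≡ w′ → P u v w → P u′ v′ w′
  transport refl refl refl p = p

inOrder⇒inSequence : ∀ {N} (σ : Permutation′ N) {P : Fin N → Fin N → Fin N → Set} →
                     InOrder (position σ) P → InSequence σ P
inOrder⇒inSequence σ h r s t r<s s<t = h _ _ _ (atPosition r<s) (atPosition s<t)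
  where
  atPosition : ∀ {i j} → i F.< j → position σ (σ ⟨$⟩ʳ i) ℕ.< position σ (σ ⟨$⟩ʳ j)
  atPosition = subst₂ ℕ._<_ (sym (cong toℕ (inverseˡ σ))) (sym (cong toℕ (inverseˡ σ)))

inOrder-pullback : ∀ {A B : Set} {ordA : A → ℕ} {ordB : B → ℕ} (e : B → A) →
  (∀ x y → ordB x ℕ.< ordB y → ordA (e x) ℕ.< ordA (e y)) →
  {P : A → A → A → Set} {Q : B → B → B → Set} → (∀ x y z → P (e x) (e y) (e z) → Q x y z) →
  InOrder ordA P → InOrder ordB Q
inOrder-pullback e mono P⇒Q h x y z x<y y<z = P⇒Q x y z (h (e x) (e y) (e z) (mono x y x<y) (mono y z y<z))

-- The two triple conditions: consistency is InSequence σ (ConsistentTriple G c),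
-- and the extra condition of strong consistency is InSequence σ (StrongTriple G c).
ConsistentTriple : (G : Graph) → ∀ {k} → (Fin (n G) → Fin k) → Fin (n G) → Fin (n G) → Fin (n G) → Set
ConsistentTriple G c u v w = c u ≡ c v → E G w u → E G w v

StrongTriple : (G : Graph) → ∀ {k} → (Fin (n G) → Fin k) → Fin (n G) → Fin (n G) → Fin (n G) → Set
StrongTriple G c u v w = c v ≡ c w → E G w u → E G v u

CliqueClasses : (G : Graph) → ∀ {k} → (Fin (n G) → Fin k) → Set
CliqueClasses G c = ∀ u v → c u ≡ c v → u ≡ v ⊎ E G u v

record Embedding (H G : Graph) : Set where
  field
    embed     : Fin (n H) → Fin (n G)
    injective : Injective _≡_ _≡_ embed
    adj-embed : ∀ x y → adj G (embed x) (embed y) ≡ adj H x y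

  edge⇔ : ∀ x y → E H x y ⇔ E G (embed x) (embed y)
  edge⇔ x y = mk⇔ (trans (adj-embed x y)) (trans (sym (adj-embed x y)))

  SameClasses : ∀ {k k′} → (Fin (n H) → Fin k′) → (Fin (n G) → Fin k) → Set
  SameClasses cH cG = ∀ x y → cH x ≡ cH y ⇔ cG (embed x) ≡ cG (embed y)

  -- Both triple conditions only involve edges and class equalities among the
  -- three vertices, so they are invariant under an embedding with agreeing classes.
  consistentTriple⇔ : ∀ {k k′} {cH : Fin (n H) → Fin k′} {cG : Fin (n G) → Fin k} →
    SameClasses cH cG → ∀ x y z →
    ConsistentTriple H cH x y z ⇔ ConsistentTriple G cG (embed x) (embed y) (embed z)
  consistentTriple⇔ same x y z = mk⇔
    (λ t eq zx → to (edge⇔ z y) (t (from (same x y) eq) (from (edge⇔ z x) zx)))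
    (λ t eq zx → from (edge⇔ z y) (t (to (same x y) eq) (to (edge⇔ z x) zx)))
    where open Equivalence

  strongTriple⇔ : ∀ {k k′} {cH : Fin (n H) → Fin k′} {cG : Fin (n G) → Fin k} →
    SameClasses cH cG → ∀ x y z →
    StrongTriple H cH x y z ⇔ StrongTriple G cG (embed x) (embed y) (embed z)
  strongTriple⇔ same x y z = mk⇔
    (λ t eq zx → to (edge⇔ y x) (t (from (same y z) eq) (from (edge⇔ z x) zx)))
    (λ t eq zx → from (edge⇔ y x) (t (to (same y z) eq) (to (edge⇔ z x) zx)))
    where open Equivalence

  cliqueClasses-pullback : ∀ {k k′} {cH : Fin (n H) → Fin k′} {cG : Fin (n G) → Fin k} →
    SameClasses cH cG → CliqueClasses G cG → CliqueClasses H cH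
  cliqueClasses-pullback same cliques x y eq =
    Sum.map injective (Equivalence.from (edge⇔ x y)) (cliques _ _ (Equivalence.to (same x y) eq))

module Restriction {H G : Graph} (φ : Embedding H G)
                   (σ : Permutation′ (n G)) {k} (c : Fin (n G) → Fin k) where
  open Embedding φ
  -- Only the classes of c that meet H survive, relabelled consecutively.
  open ImageRank (c ∘ embed) public using (size)
  open ImageRank (c ∘ embed) using () renaming (label to classOf; label-surjective to classOf-surjective)

  sameClasses : SameClasses classOf c
  sameClasses = ImageRank.label-≡ (c ∘ embed)

  ordering : Σ (Permutation′ (n H)) λ π →
               ∀ x y → position π x ℕ.< position π y → position σ (embed x) ℕ.< position σ (embed y)
  ordering = inducedOrdering (λ x → σ ⟨$⟩ˡ embed x) (injective ∘ inverse-injective σ)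

  π : Permutation′ (n H)
  π = proj₁ ordering

  restrictTriples : ∀ {P : Fin (n G) → Fin (n G) → Fin (n G) → Set} {Q : Fin (n H) → Fin (n H) → Fin (n H) → Set} →
    (∀ x y z → P (embed x) (embed y) (embed z) → Q x y z) → InSequence σ P → InSequence π Q
  restrictTriples {P} P⇒Q h =
    inOrder⇒inSequence π (inOrder-pullback embed (proj₂ ordering) {P} P⇒Q (inSequence⇒inOrder σ h))

  restrictPartition : CliquePartition G c → CliquePartition H classOf
  restrictPartition (_ , cliques) = classOf-surjective , cliqueClasses-pullback {cG = c} sameClasses cliques

  restrictThin : CliquePartition G c → Consistent G σ c → CompThinWith H size
  restrictThin partition consistent = π , classOf , restrictPartition partition ,
    restrictTriples {ConsistentTriple G c} {ConsistentTriple H classOf}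
      (λ x y z → Equivalence.from (consistentTriple⇔ {cG = c} sameClasses x y z)) consistent

  restrictPThin : CliquePartition G c → StronglyConsistent G σ c → CompPThinWith H size
  restrictPThin partition (consistent , strong) = π , classOf , restrictPartition partition ,
    restrictTriples {ConsistentTriple G c} {ConsistentTriple H classOf}
      (λ x y z → Equivalence.from (consistentTriple⇔ {cG = c} sameClasses x y z)) consistent ,
    restrictTriples {StrongTriple G c} {StrongTriple H classOf}
      (λ x y z → Equivalence.from (strongTriple⇔ {cG = c} sameClasses x y z)) strong

Splits : (ℕ → Set) → (ℕ → Set) → ℕ → Set
Splits P₁ P₂ k = ∃ λ k₁ → ∃ λ k₂ → P₁ k₁ × P₂ k₂ × k₁ + k₂ ℕ.≤ k

isMin-+ : ∀ {P₁ P₂ P : ℕ → Set} →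
  (∀ {k₁ k₂} → P₁ k₁ → P₂ k₂ → P (k₁ + k₂)) → (∀ {k} → P k → Splits P₁ P₂ k) →
  ∀ {k₁ k₂} → IsMin P₁ k₁ → IsMin P₂ k₂ → IsMin P (k₁ + k₂)
isMin-+ {P₁} {P₂} combine split {k₁} {k₂} (p₁ , min₁) (p₂ , min₂) =
  combine p₁ p₂ , λ k p → lowerBound (split p)
  where
  lowerBound : ∀ {k} → Splits P₁ P₂ k → k₁ + k₂ ℕ.≤ k
  lowerBound (l₁ , l₂ , q₁ , q₂ , l₁+l₂≤k) = ℕP.≤-trans (ℕP.+-mono-≤ (min₁ l₁ q₁) (min₂ l₂ q₂)) l₁+l₂≤k

data Side (a b : ℕ) : Fin (a + b) → Set where
  left  : (x : Fin a) → Side a b (x ↑ˡ b)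
  right : (y : Fin b) → Side a b (a ↑ʳ y)

side : ∀ a b v → Side a b v
side a b v with splitAt a v | FP.join-splitAt a b v
... | inj₁ x | eq = subst (Side a b) eq (left x)
... | inj₂ y | eq = subst (Side a b) eq (right y)

↑ˡ≢↑ʳ : ∀ {a b} (x : Fin a) (y : Fin b) → x ↑ˡ b ≢ a ↑ʳ y
↑ˡ≢↑ʳ {a} {b} x y eq with trans (sym (FP.splitAt-↑ˡ a x b)) (trans (cong (splitAt a) eq) (FP.splitAt-↑ʳ a b y))
... | ()

module Union (G₁ G₂ : Graph) where
  private
    a = n G₁
    b = n G₂
    U = G₁ ∪G G₂

  leftEmbedding : Embedding G₁ U
  leftEmbedding = record { embed = _↑ˡ b ; injective = FP.↑ˡ-injective b _ _ ; adj-embed = adj-left }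
    where
    adj-left : ∀ x y → adj U (x ↑ˡ b) (y ↑ˡ b) ≡ adj G₁ x y
    adj-left x y rewrite FP.splitAt-↑ˡ a x b | FP.splitAt-↑ˡ a y b = refl

  rightEmbedding : Embedding G₂ U
  rightEmbedding = record { embed = a ↑ʳ_ ; injective = FP.↑ʳ-injective a _ _ ; adj-embed = adj-right }
    where
    adj-right : ∀ x y → adj U (a ↑ʳ x) (a ↑ʳ y) ≡ adj G₂ x y
    adj-right x y rewrite FP.splitAt-↑ʳ a b x | FP.splitAt-↑ʳ a b y = refl

  noCrossEdge : ∀ x y → ¬ E U (x ↑ˡ b) (a ↑ʳ y)
  noCrossEdge x y rewrite FP.splitAt-↑ˡ a x b | FP.splitAt-↑ʳ a b y = λ ()

  noCrossEdge′ : ∀ x y → ¬ E U (a ↑ʳ y) (x ↑ˡ b)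
  noCrossEdge′ x y rewrite FP.splitAt-↑ˡ a x b | FP.splitAt-↑ʳ a b y = λ ()

  -- Lower bound: a clique class of U cannot meet both summands, so restricting
  -- a witness for U to G₁ and G₂ uses disjoint sets of classes.
  classesDisjoint : ∀ {k} (c : Fin (n U) → Fin k) → CliqueClasses U c →
                    ImageRank.size (c ∘ (_↑ˡ b)) + ImageRank.size (c ∘ (a ↑ʳ_)) ℕ.≤ k
  classesDisjoint c cliques =
    count-disjoint (ImageRank.inImage? (c ∘ (_↑ˡ b))) (ImageRank.inImage? (c ∘ (a ↑ʳ_)))
      λ { j (x , cx≡j) (y , cy≡j) → noCrossClass x y (trans cx≡j (sym cy≡j)) }
    where
    noCrossClass : ∀ x y → ¬ c (x ↑ˡ b) ≡ c (a ↑ʳ y)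
    noCrossClass x y eq with cliques _ _ eq
    ... | inj₁ same = ↑ˡ≢↑ʳ x y same
    ... | inj₂ edge = noCrossEdge x y edge

  splitThin : ∀ {k} → CompThinWith U k → Splits (CompThinWith G₁) (CompThinWith G₂) k
  splitThin (σ , c , partition , consistent) = _ , _ ,
    Restriction.restrictThin leftEmbedding σ c partition consistent ,
    Restriction.restrictThin rightEmbedding σ c partition consistent ,
    classesDisjoint c (proj₂ partition)

  splitPThin : ∀ {k} → CompPThinWith U k → Splits (CompPThinWith G₁) (CompPThinWith G₂) k
  splitPThin (σ , c , partition , strong) = _ , _ ,
    Restriction.restrictPThin leftEmbedding σ c partition strong ,
    Restriction.restrictPThin rightEmbedding σ c partition strong ,
    classesDisjoint c (proj₂ partition)

  -- Upper bound: order G₁ before G₂ and use the classes of G₁ followed by those of G₂.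
  module _ {k₁ k₂} (σ₁ : Permutation′ a) (c₁ : Fin a → Fin k₁) (σ₂ : Permutation′ b) (c₂ : Fin b → Fin k₂) where
    open Embedding using (SameClasses; consistentTriple⇔; strongTriple⇔; edge⇔)
    open Equivalence using (to; from)

    σU : Permutation′ (a + b)
    σU = ↔-sym FP.+↔⊎ ↔-∘ ((σ₁ ⊎-↔ σ₂) ↔-∘ FP.+↔⊎)

    cU : Fin (a + b) → Fin (k₁ + k₂)
    cU v = join k₁ k₂ (Sum.map c₁ c₂ (splitAt a v))

    position-left : ∀ x → position σU (x ↑ˡ b) ≡ position σ₁ x
    position-left x rewrite FP.splitAt-↑ˡ a x b = FP.toℕ-↑ˡ _ b

    position-right : ∀ y → position σU (a ↑ʳ y) ≡ a + position σ₂ y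
    position-right y rewrite FP.splitAt-↑ʳ a b y = FP.toℕ-↑ʳ a _

    class-left : ∀ x → cU (x ↑ˡ b) ≡ c₁ x ↑ˡ k₂
    class-left x rewrite FP.splitAt-↑ˡ a x b = refl

    class-right : ∀ y → cU (a ↑ʳ y) ≡ k₁ ↑ʳ c₂ y
    class-right y rewrite FP.splitAt-↑ʳ a b y = refl

    sameClasses-left : SameClasses leftEmbedding c₁ cU
    sameClasses-left x y rewrite class-left x | class-left y = mk⇔ (cong (_↑ˡ k₂)) (FP.↑ˡ-injective k₂ _ _)

    sameClasses-right : SameClasses rightEmbedding c₂ cU
    sameClasses-right x y rewrite class-right x | class-right y = mk⇔ (cong (k₁ ↑ʳ_)) (FP.↑ʳ-injective k₁ _ _)

    classes-apart : ∀ x y → ¬ cU (x ↑ˡ b) ≡ cU (a ↑ʳ y)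
    classes-apart x y rewrite class-left x | class-right y = ↑ˡ≢↑ʳ (c₁ x) (c₂ y)

    left-< : ∀ x y → position σU (x ↑ˡ b) ℕ.< position σU (y ↑ˡ b) → position σ₁ x ℕ.< position σ₁ y
    left-< x y = subst₂ ℕ._<_ (position-left x) (position-left y)

    right-< : ∀ x y → position σU (a ↑ʳ x) ℕ.< position σU (a ↑ʳ y) → position σ₂ x ℕ.< position σ₂ y
    right-< x y lt = ℕP.+-cancelˡ-< a _ _ (subst₂ ℕ._<_ (position-right x) (position-right y) lt)

    -- A triple meeting both summands satisfies the triple conditions vacuously:
    -- its class equality or its edge would cross between the summands.
    consistentU : Consistent G₁ σ₁ c₁ → Consistent G₂ σ₂ c₂ → Consistent U σU cU
    consistentU h₁ h₂ = inOrder⇒inSequence σU inOrderU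
      where
      inOrderU : InOrder (position σU) (ConsistentTriple U cU)
      inOrderU u v w u<v v<w with side a b u | side a b v | side a b w
      ... | left x  | left y  | left z  = to (consistentTriple⇔ leftEmbedding {cG = cU} sameClasses-left x y z)
                                            (inSequence⇒inOrder σ₁ h₁ x y z (left-< x y u<v) (left-< y z v<w))
      ... | right x | right y | right z = to (consistentTriple⇔ rightEmbedding {cG = cU} sameClasses-right x y z)
                                            (inSequence⇒inOrder σ₂ h₂ x y z (right-< x y u<v) (right-< y z v<w))
      ... | left x  | right y | _       = λ eq _ → ⊥-elim (classes-apart x y eq)
      ... | right x | left y  | _       = λ eq _ → ⊥-elim (classes-apart y x (sym eq))
      ... | left x  | left _  | right z = λ _ zx → ⊥-elim (noCrossEdge′ x z zx)
      ... | right x | right _ | left z  = λ _ zx → ⊥-elim (noCrossEdge z x zx)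

    strongU : InSequence σ₁ (StrongTriple G₁ c₁) → InSequence σ₂ (StrongTriple G₂ c₂) → InSequence σU (StrongTriple U cU)
    strongU h₁ h₂ = inOrder⇒inSequence σU inOrderU
      where
      inOrderU : InOrder (position σU) (StrongTriple U cU)
      inOrderU u v w u<v v<w with side a b u | side a b v | side a b w
      ... | left x  | left y  | left z  = to (strongTriple⇔ leftEmbedding {cG = cU} sameClasses-left x y z)
                                            (inSequence⇒inOrder σ₁ h₁ x y z (left-< x y u<v) (left-< y z v<w))
      ... | right x | right y | right z = to (strongTriple⇔ rightEmbedding {cG = cU} sameClasses-right x y z)
                                            (inSequence⇒inOrder σ₂ h₂ x y z (right-< x y u<v) (right-< y z v<w))
      ... | _       | left y  | right z = λ eq _ → ⊥-elim (classes-apart y z eq)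
      ... | _       | right y | left z  = λ eq _ → ⊥-elim (classes-apart z y (sym eq))
      ... | right x | left _  | left z  = λ _ zx → ⊥-elim (noCrossEdge z x zx)
      ... | left x  | right _ | right z = λ _ zx → ⊥-elim (noCrossEdge′ x z zx)

    partitionU : CliquePartition G₁ c₁ → CliquePartition G₂ c₂ → CliquePartition U cU
    partitionU (surjective₁ , cliques₁) (surjective₂ , cliques₂) = surjective , cliques
      where
      surjective : Surjective _≡_ _≡_ cU
      surjective j with side k₁ k₂ j
      ... | left i  = let (x , cx≡i) = surjective₁ i in
                      x ↑ˡ b , λ { refl → trans (class-left x) (cong (_↑ˡ k₂) (cx≡i refl)) }
      ... | right i = let (y , cy≡i) = surjective₂ i in
                      a ↑ʳ y , λ { refl → trans (class-right y) (cong (k₁ ↑ʳ_) (cy≡i refl)) }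
      cliques : CliqueClasses U cU
      cliques u v eq with side a b u | side a b v
      ... | left x  | left y  = Sum.map (cong (_↑ˡ b)) (to (edge⇔ leftEmbedding x y))
                                  (cliques₁ x y (from (sameClasses-left x y) eq))
      ... | right x | right y = Sum.map (cong (a ↑ʳ_)) (to (edge⇔ rightEmbedding x y))
                                  (cliques₂ x y (from (sameClasses-right x y) eq))
      ... | left x  | right y = ⊥-elim (classes-apart x y eq)
      ... | right x | left y  = ⊥-elim (classes-apart y x (sym eq))

  combineThin : ∀ {k₁ k₂} → CompThinWith G₁ k₁ → CompThinWith G₂ k₂ → CompThinWith U (k₁ + k₂)
  combineThin (σ₁ , c₁ , partition₁ , consistent₁) (σ₂ , c₂ , partition₂ , consistent₂) =
    σU σ₁ c₁ σ₂ c₂ , cU σ₁ c₁ σ₂ c₂ , partitionU σ₁ c₁ σ₂ c₂ partition₁ partition₂ ,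
    consistentU σ₁ c₁ σ₂ c₂ consistent₁ consistent₂

  combinePThin : ∀ {k₁ k₂} → CompPThinWith G₁ k₁ → CompPThinWith G₂ k₂ → CompPThinWith U (k₁ + k₂)
  combinePThin (σ₁ , c₁ , partition₁ , consistent₁ , strong₁) (σ₂ , c₂ , partition₂ , consistent₂ , strong₂) =
    σU σ₁ c₁ σ₂ c₂ , cU σ₁ c₁ σ₂ c₂ , partitionU σ₁ c₁ σ₂ c₂ partition₁ partition₂ ,
    consistentU σ₁ c₁ σ₂ c₂ consistent₁ consistent₂ , strongU σ₁ c₁ σ₂ c₂ strong₁ strong₂

theorem4p10 : (G₁ G₂ : Graph) →
    (∀ k₁ k₂ → IsCompThin G₁ k₁ → IsCompThin G₂ k₂ → IsCompThin (G₁ ∪G G₂) (k₁ + k₂)) ×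
    (∀ k₁ k₂ → IsCompPThin G₁ k₁ → IsCompPThin G₂ k₂ → IsCompPThin (G₁ ∪G G₂) (k₁ + k₂))
theorem4p10 G₁ G₂ =
  (λ _ _ → isMin-+ combineThin splitThin) ,
  (λ _ _ → isMin-+ combinePThin splitPThin)
  where open Union G₁ G₂
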